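{- Let $n\ge d$ be positive integers, $L=\{\ell_1,\dots,\ell_n\}$, $R=\{r_1,\dots,r_d\}$. For a linkage $(n,d)$-matching field $\mathcal M$ on $L\sqcup R$, let $\varphi_{\mathcal M}$ be the map from the $(n-d+1)$-subsets $\rho\subseteq L$ to $\{v\in\mathbb Z_{\ge0}^d:\sum_i v_i=n-d+1\}$ sending $\rho$ to the right degree vector of the Chow covector $\Omega_\rho$. If $\mathcal M$ and $\mathcal M'$ are linkage $(n,d)$-matching fields on $L\sqcup R$ with $\varphi_{\mathcal M}=\varphi_{\mathcal M'}$, then $\mathcal M=\mathcal M'$.
   Context: Bipartite graphs on $L\sqcup R$ are identified with their edge sets; the right degree vector of such a graph is the tuple of degrees of $r_1,\dots,r_d$. An $(n,d)$-matching field $\mathcal M=(M_\sigma)$ assigns to each $d$-element subset $\sigma\subseteq L$ a perfect matching $M_\sigma$ on $\sigma\sqcup R$; $M_\sigma(\ell_j)$ denotes the right node matched to $\ell_j\in\sigma$. It is linkage if for every $(d+1)$-subset $\tau\subseteq L$ the union of the matchings $M_\sigma$, $\sigma\subset\tau$, $|\sigma|=d$, is a tree on $\tau\sqcup R$. For an $(n-d+1)$-subset $\rho\subseteq L$, the Chow covector $\Omega_\rho$ is the graph with edge set $\{(\ell_j,M_{(L\setminus\rho)\cup\{\ell_j\}}(\ell_j)):\ell_j\in\rho\}$. -}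

module Defs where

open import Data.Nat using (ℕ; zero; suc; _∸_; _+_)
open import Data.Fin using (Fin; zero; suc; inject₁; fromℕ; _≟_)
open import Data.Fin.Subset using (Subset; _∈_; _⊆_; ∁; _∪_; ⁅_⁆; ∣_∣)
open import Data.Fin.Subset.Properties using (_∈?_)
open import Data.List using (List; length; filter; allFin)
open import Data.Sum using (_⊎_; inj₁; inj₂)
open import Data.Product using (Σ; _×_; ∃)
open import Data.Empty using (⊥)
open import Relation.Nullary using (¬_)
open import Relation.Nullary.Decidable using (_×-dec_)
open import Relation.Binary.PropositionalEquality using (_≡_)
open import Relation.Binary.Construct.Closure.ReflexiveTransitive using (Star)
open import Function.Definitions using (Injective)

-- Left nodes L = Fin n, right nodes R = Fin d.
-- A bipartite graph on L ⊔ R, identified with its edge set (a predicate).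
BipGraph : ℕ → ℕ → Set₁
BipGraph n d = Fin n → Fin d → Set

-- A matching-field datum: to each subset σ ⊆ L, a map assigning to each
-- ℓ ∈ σ a right node  M σ ℓ  (values for ℓ ∉ σ or |σ| ≠ d are irrelevant).
MatchingData : ℕ → ℕ → Set
MatchingData n d = Subset n → Fin n → Fin d

IsPerfectMatching : ∀ {n d} → Subset n → (Fin n → Fin d) → Set
IsPerfectMatching {n} {d} σ f =
  (∀ {ℓ ℓ'} → ℓ ∈ σ → ℓ' ∈ σ → f ℓ ≡ f ℓ' → ℓ ≡ ℓ')
  × (∀ (r : Fin d) → Σ (Fin n) λ ℓ → ℓ ∈ σ × f ℓ ≡ r)

IsMatchingField : ∀ {n d} → MatchingData n d → Set
IsMatchingField {n} {d} M = ∀ (σ : Subset n) → ∣ σ ∣ ≡ d → IsPerfectMatching σ (M σ)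

Vertex : ℕ → ℕ → Set
Vertex n d = Fin n ⊎ Fin d

Adj : ∀ {n d} → BipGraph n d → Vertex n d → Vertex n d → Set
Adj G (inj₁ ℓ) (inj₂ r) = G ℓ r
Adj G (inj₂ r) (inj₁ ℓ) = G ℓ r
Adj G (inj₁ _) (inj₁ _) = ⊥
Adj G (inj₂ _) (inj₂ _) = ⊥

InVerts : ∀ {n d} → Subset n → Vertex n d → Set
InVerts τ (inj₁ ℓ) = ℓ ∈ τ
InVerts τ (inj₂ r) = Data.Unit.⊤ where import Data.Unit

OnVerts : ∀ {n d} → Subset n → BipGraph n d → Set
OnVerts {n} {d} τ G = ∀ (ℓ : Fin n) (r : Fin d) → G ℓ r → ℓ ∈ τ

Connected : ∀ {n d} → Subset n → BipGraph n d → Set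
Connected {n} {d} τ G =
  ∀ (u v : Vertex n d) → InVerts τ u → InVerts τ v → Star (Adj G) u v

-- A cycle ℓ₀ r₀ ℓ₁ r₁ … ℓₘ rₘ ℓ₀ with m ≥ 1 (length 2(m+1) ≥ 4),
-- pairwise distinct left nodes and pairwise distinct right nodes.
record Cycle {n d : ℕ} (G : BipGraph n d) : Set where
  field
    m      : ℕ
    ls     : Fin (suc (suc m)) → Fin n
    rs     : Fin (suc (suc m)) → Fin d
    ls-inj : Injective _≡_ _≡_ ls
    rs-inj : Injective _≡_ _≡_ rs
    e-down : ∀ i → G (ls i) (rs i)
    e-up   : ∀ (i : Fin (suc m)) → G (ls (suc i)) (rs (inject₁ i))
    e-wrap : G (ls zero) (rs (fromℕ (suc m)))

Acyclic : ∀ {n d} → BipGraph n d → Set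
Acyclic G = ¬ Cycle G

IsTree : ∀ {n d} → Subset n → BipGraph n d → Set
IsTree τ G = OnVerts τ G × Connected τ G × Acyclic G

UnionOfMatchings : ∀ {n d} → MatchingData n d → Subset n → BipGraph n d
UnionOfMatchings {n} {d} M τ ℓ r =
  Σ (Subset n) λ σ → σ ⊆ τ × ∣ σ ∣ ≡ d × ℓ ∈ σ × M σ ℓ ≡ r

IsLinkage : ∀ {n d} → MatchingData n d → Set
IsLinkage {n} {d} M =
  ∀ (τ : Subset n) → ∣ τ ∣ ≡ suc d → IsTree τ (UnionOfMatchings M τ)

ChowCovector : ∀ {n d} → MatchingData n d → Subset n → BipGraph n d
ChowCovector M ρ ℓ r = ℓ ∈ ρ × M (∁ ρ ∪ ⁅ ℓ ⁆) ℓ ≡ r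

chowRightDegree : ∀ {n d} → MatchingData n d → Subset n → Fin d → ℕ
chowRightDegree {n} M ρ r =
  length (filter (λ ℓ → (ℓ ∈? ρ) ×-dec (M (∁ ρ ∪ ⁅ ℓ ⁆) ℓ ≟ r)) (allFin n))

φ : ∀ {n d} → MatchingData n d → Subset n → Fin d → ℕ
φ = chowRightDegree

SameMatchingField : ∀ {n d} → MatchingData n d → MatchingData n d → Set
SameMatchingField {n} {d} M M' =
  ∀ (σ : Subset n) → ∣ σ ∣ ≡ d → ∀ (ℓ : Fin n) → ℓ ∈ σ → M σ ℓ ≡ M' σ ℓ

module Submission where

-- For a subset p ⊆ L and x ∈ L write  co p x = (L ∖ p) ∪ {x}.  For a d-subset
-- σ and x ∈ σ, co σ x is an (n-d+1)-subset with co (co σ x) x = σ, so the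
-- Chow covector Ω_{co σ x} contains the edge (x, M_σ(x)).
--
-- The heart of the proof is a DEGREE DROP (module DegreeDrop): for distinct
-- a, s ∈ σ and r = M_σ(a), the right degree of r is strictly smaller in
-- Ω_{co σ s} than in Ω_{co σ a}.  Indeed (a, r) is an edge of Ω_{co σ a} but
-- not of Ω_{co σ s}, and every r-edge (b, r) of Ω_{co σ s} is an edge of
-- Ω_{co σ a}.  For b ∉ σ the latter is the LINKAGE EXCHANGE lemma: walking
-- alternately along M_{σ-a+b}⁻¹ and M_σ inside τ = σ ∪ {b} (an orbit of a
-- partial injection of R, which must stop by pigeonhole) either closes at once
-- or closes a cycle in the union of the matchings of τ, which is a tree.
--
-- Theorem: if M_σ(ℓ) ≠ M'_σ(ℓ) = r, let s ∈ σ with M_σ(s) = r.  The degree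
-- drops for M (from s to ℓ) and for M' (from ℓ to s) give
--   φ_M(co σ ℓ)(r) < φ_M(co σ s)(r) = φ_M'(co σ s)(r) < φ_M'(co σ ℓ)(r),
-- contradicting φ_M = φ_M' at co σ ℓ.

open import Defs
open import Data.Nat using (ℕ; zero; suc; _≤_; _<_; _∸_; _+_; z≤n; s≤s)
open import Data.Nat.Properties
  using (+-comm; ∸-+-assoc; m∸[m∸n]≡n; m≤n⇒m≤1+n; m<n⇒m<1+n; <-≤-trans; ≤-pred; n<1+n;
         m<1+n⇒m<n∨m≡n; <-cmp; <-irrefl; <-trans; module ≤-Reasoning)
open import Data.Fin using (Fin; zero; suc; _≟_; toℕ; fromℕ; inject₁)
open import Data.Fin.Properties using (toℕ-injective; toℕ<n; toℕ-fromℕ; toℕ-inject₁; pigeonhole)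
open import Data.Fin.Subset using (Subset; _∈_; _∉_; _⊆_; ∁; _∪_; ⁅_⁆; ∣_∣; inside; outside)
open import Data.Fin.Subset.Properties
  using (x∈p∪q⁻; x∈p∪q⁺; x∈∁p⇒x∉p; x∉p⇒x∈∁p; x∈p⇒x∉∁p; x∈⁅x⁆; x∈⁅y⁆⇒x≡y;
         ⊆-antisym; ∪-identityʳ; ∣∁p∣≡n∸∣p∣; _∈?_)
open import Data.Vec using (_∷_; here; there)
open import Data.List using ([]; _∷_; length; filter; allFin)
open import Data.List.Membership.Propositional using () renaming (_∈_ to _∈ₗ_)
open import Data.List.Membership.Propositional.Properties using (∈-allFin)
open import Data.List.Relation.Unary.Any using (here; there)
open import Data.Sum using (_⊎_; inj₁; inj₂; [_,_])
open import Data.Product using (Σ; _×_; _,_; proj₁; proj₂)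
open import Data.Empty using (⊥-elim)
open import Relation.Nullary using (¬_; yes; no)
open import Relation.Nullary.Decidable using (_×-dec_)
open import Relation.Unary using (Decidable)
open import Relation.Binary.Definitions using (tri<; tri≈; tri>)
open import Relation.Binary.PropositionalEquality using (_≡_; _≢_; refl; sym; trans; cong; subst; module ≡-Reasoning)

count-mono : ∀ {A : Set} {P Q : A → Set} (P? : Decidable P) (Q? : Decidable Q) →
  (∀ x → P x → Q x) → ∀ xs → length (filter P? xs) ≤ length (filter Q? xs)
count-mono P? Q? P⇒Q [] = z≤n
count-mono P? Q? P⇒Q (x ∷ xs) with P? x | Q? x
... | yes _ | yes _ = s≤s (count-mono P? Q? P⇒Q xs)
... | yes p | no ¬q = ⊥-elim (¬q (P⇒Q x p))
... | no _  | yes _ = m≤n⇒m≤1+n (count-mono P? Q? P⇒Q xs)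
... | no _  | no _  = count-mono P? Q? P⇒Q xs

count-strict : ∀ {A : Set} {P Q : A → Set} (P? : Decidable P) (Q? : Decidable Q) →
  (∀ x → P x → Q x) → ∀ {y} xs → y ∈ₗ xs → Q y → ¬ P y →
  length (filter P? xs) < length (filter Q? xs)
count-strict P? Q? P⇒Q (x ∷ xs) (here refl) qy ¬py with P? x | Q? x
... | yes p | _     = ⊥-elim (¬py p)
... | no _  | yes _ = s≤s (count-mono P? Q? P⇒Q xs)
... | no _  | no ¬q = ⊥-elim (¬q qy)
count-strict P? Q? P⇒Q (x ∷ xs) (there y∈xs) qy ¬py with P? x | Q? x
... | yes _ | yes _ = s≤s (count-strict P? Q? P⇒Q xs y∈xs qy ¬py)
... | yes p | no ¬q = ⊥-elim (¬q (P⇒Q x p))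
... | no _  | yes _ = m≤n⇒m≤1+n (count-strict P? Q? P⇒Q xs y∈xs qy ¬py)
... | no _  | no _  = count-strict P? Q? P⇒Q xs y∈xs qy ¬py

Before : (ℕ → Set) → ℕ → Set
Before P k = ∀ t → t < k → ¬ P t

before-pred : ∀ {P : ℕ → Set} {k} → Before P (suc k) → Before P k
before-pred before t t<k = before t (m<n⇒m<1+n t<k)

firstOccurrence : ∀ {P : ℕ → Set} → Decidable P → ∀ k →
  Before P k ⊎ Σ ℕ (λ j → Before P j × P j)
firstOccurrence P? zero = inj₁ (λ t ())
firstOccurrence P? (suc k) with firstOccurrence P? k
... | inj₂ first = inj₂ first
... | inj₁ before with P? k
...   | yes p = inj₂ (k , before , p)
...   | no ¬p = inj₁ extend
  where
  extend : Before _ (suc k)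
  extend t t<1+k with m<1+n⇒m<n∨m≡n t<1+k
  ... | inj₁ t<k = before t t<k
  ... | inj₂ refl = ¬p

-- Orbit of start under a map  step  that is injective away from the point
-- stop and never returns to start: it is injective until it hits stop, and by
-- pigeonhole it does hit stop.
module Orbit {d : ℕ} (step : Fin d → Fin d) (stop start : Fin d)
  (step-inj : ∀ {r r'} → r ≢ stop → r' ≢ stop → step r ≡ step r' → r ≡ r')
  (start-fresh : ∀ {r} → r ≢ stop → step r ≢ start) where

  orbit : ℕ → Fin d
  orbit zero = start
  orbit (suc t) = step (orbit t)

  Hits : ℕ → Set
  Hits t = orbit t ≡ stop

  orbit-distinct : ∀ {i j} → i < j → Before Hits j → orbit i ≢ orbit j
  orbit-distinct {j = zero} ()
  orbit-distinct {zero} {suc j} _ before e = start-fresh (before j (n<1+n j)) (sym e)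
  orbit-distinct {suc i} {suc j} (s≤s i<j) before e =
    orbit-distinct i<j (before-pred before)
      (step-inj (before i (m<n⇒m<1+n i<j)) (before j (n<1+n j)) e)

  orbit-injective : ∀ {k i j} → Before Hits k → i ≤ k → j ≤ k → orbit i ≡ orbit j → i ≡ j
  orbit-injective {k} {i} {j} before i≤k j≤k e with <-cmp i j
  ... | tri< i<j _ _ = ⊥-elim (orbit-distinct i<j (λ t t<j → before t (<-≤-trans t<j j≤k)) e)
  ... | tri≈ _ i≡j _ = i≡j
  ... | tri> _ _ j<i = ⊥-elim (orbit-distinct j<i (λ t t<i → before t (<-≤-trans t<i i≤k)) (sym e))

  orbit-reaches-stop : Σ ℕ λ k → Before Hits k × Hits k
  orbit-reaches-stop with firstOccurrence (λ t → orbit t ≟ stop) (suc d)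
  ... | inj₂ first = first
  ... | inj₁ before with pigeonhole (n<1+n d) (λ i → orbit (toℕ i))
  ...   | i , j , i<j , e =
    ⊥-elim (orbit-distinct i<j (λ t t<j → before t (<-trans t<j (toℕ<n j))) e)

card-add : ∀ {n} (p : Subset n) (y : Fin n) → y ∉ p → ∣ p ∪ ⁅ y ⁆ ∣ ≡ suc ∣ p ∣
card-add (outside ∷ p) zero    y∉p = cong suc (cong ∣_∣ (∪-identityʳ p))
card-add (inside  ∷ p) zero    y∉p = ⊥-elim (y∉p here)
card-add (outside ∷ p) (suc y) y∉p = card-add p y (λ y∈p → y∉p (there y∈p))
card-add (inside  ∷ p) (suc y) y∉p = cong suc (card-add p y (λ y∈p → y∉p (there y∈p)))

-- co p x = (L ∖ p) ∪ {x}: the d-subsets and the (n-d+1)-subsets of the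
-- Chow covectors are exchanged by it.
co : ∀ {n} → Subset n → Fin n → Subset n
co p x = ∁ p ∪ ⁅ x ⁆

co⁻ : ∀ {n} {p : Subset n} {x y} → y ∈ co p x → y ∉ p ⊎ y ≡ x
co⁻ {p = p} {x} y∈ with x∈p∪q⁻ (∁ p) ⁅ x ⁆ y∈
... | inj₁ y∈∁p = inj₁ (x∈∁p⇒x∉p y∈∁p)
... | inj₂ y∈x  = inj₂ (x∈⁅y⁆⇒x≡y x y∈x)

co⁺ : ∀ {n} {p : Subset n} {x y} → y ∉ p ⊎ y ≡ x → y ∈ co p x
co⁺ (inj₁ y∉p) = x∈p∪q⁺ (inj₁ (x∉p⇒x∈∁p y∉p))
co⁺ {x = x} (inj₂ refl) = x∈p∪q⁺ (inj₂ (x∈⁅x⁆ x))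

co-card : ∀ {n} {p : Subset n} {x} → x ∈ p → ∣ co p x ∣ ≡ suc (n ∸ ∣ p ∣)
co-card {p = p} {x} x∈p = trans (card-add (∁ p) x (x∈p⇒x∉∁p x∈p)) (cong suc (∣∁p∣≡n∸∣p∣ p))

co-card-d : ∀ {n d} {σ : Subset n} {x} → ∣ σ ∣ ≡ d → x ∈ σ → ∣ co σ x ∣ ≡ n ∸ d + 1
co-card-d {n} {d} hσ x∈σ = trans (co-card x∈σ) (trans (cong (λ k → suc (n ∸ k)) hσ) (+-comm 1 (n ∸ d)))

co-card-N : ∀ {n d} → 1 ≤ d → d ≤ n → ∀ {ρ : Subset n} {x} →
  ∣ ρ ∣ ≡ n ∸ d + 1 → x ∈ ρ → ∣ co ρ x ∣ ≡ d
co-card-N {n} {suc d} (s≤s z≤n) 1+d≤n {ρ} hρ x∈ρ = begin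
  ∣ co ρ _ ∣                      ≡⟨ co-card x∈ρ ⟩
  suc (n ∸ ∣ ρ ∣)                  ≡⟨ cong (λ k → suc (n ∸ k)) hρ ⟩
  suc (n ∸ (n ∸ suc d + 1))       ≡⟨ cong suc (sym (∸-+-assoc n (n ∸ suc d) 1)) ⟩
  suc (n ∸ (n ∸ suc d) ∸ 1)       ≡⟨ cong (λ k → suc (k ∸ 1)) (m∸[m∸n]≡n 1+d≤n) ⟩
  suc d                           ∎
  where open ≡-Reasoning

co-co⁻ : ∀ {n} {p : Subset n} {x z y} → y ∈ co (co p x) z → (y ∈ p × y ≢ x) ⊎ y ≡ z
co-co⁻ {p = p} {x} {y = y} y∈ with co⁻ y∈
... | inj₂ y≡z = inj₂ y≡z
... | inj₁ y∉co with y ∈? p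
...   | no y∉p = ⊥-elim (y∉co (co⁺ (inj₁ y∉p)))
...   | yes y∈p = inj₁ (y∈p , λ y≡x → y∉co (co⁺ (inj₂ y≡x)))

co-co⊆ : ∀ {n} {p : Subset n} {x z} → co (co p x) z ⊆ p ∪ ⁅ z ⁆
co-co⊆ {z = z} y∈ with co-co⁻ y∈
... | inj₁ (y∈p , _) = x∈p∪q⁺ (inj₁ y∈p)
... | inj₂ refl = x∈p∪q⁺ (inj₂ (x∈⁅x⁆ z))

co-involutive : ∀ {n} {p : Subset n} {x} → x ∈ p → co (co p x) x ≡ p
co-involutive {p = p} {x} x∈p = ⊆-antisym forth back
  where
  forth : co (co p x) x ⊆ p
  forth y∈ with co-co⁻ y∈
  ... | inj₁ (y∈p , _) = y∈p
  ... | inj₂ refl = x∈p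
  back : p ⊆ co (co p x) x
  back {y} y∈p with y ≟ x
  ... | yes y≡x = co⁺ (inj₂ y≡x)
  ... | no y≢x = co⁺ (inj₁ λ y∈co → [ (λ y∉p → y∉p y∈p) , y≢x ] (co⁻ y∈co))

module LinkageExchange {n d : ℕ} (M : MatchingData n d) (mf : IsMatchingField M) (lk : IsLinkage M)
  {A B C : Subset n} {a b : Fin n}
  (hA : ∣ A ∣ ≡ d) (a∈A : a ∈ A) (b∉A : b ∉ A)
  (hB : ∣ B ∣ ≡ d) (B⊆ : B ⊆ A ∪ ⁅ b ⁆) (b∈B : b ∈ B) (a∉B : a ∉ B)
  (hC : ∣ C ∣ ≡ d) (C⊆ : C ⊆ A ∪ ⁅ b ⁆) (b∈C : b ∈ C)
  (Cb≡Aa : M C b ≡ M A a) where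

  τ : Subset n
  τ = A ∪ ⁅ b ⁆

  G : BipGraph n d
  G = UnionOfMatchings M τ

  edge : ∀ {D x r} → D ⊆ τ → ∣ D ∣ ≡ d → x ∈ D → M D x ≡ r → G x r
  edge {D} D⊆τ hD x∈D e = D , D⊆τ , hD , x∈D , e

  injA : ∀ {x x'} → x ∈ A → x' ∈ A → M A x ≡ M A x' → x ≡ x'
  injA = proj₁ (mf A hA)

  B⁻¹ : Fin d → Fin n
  B⁻¹ r = proj₁ (proj₂ (mf B hB) r)

  B⁻¹∈B : ∀ r → B⁻¹ r ∈ B
  B⁻¹∈B r = proj₁ (proj₂ (proj₂ (mf B hB) r))

  M-B⁻¹ : ∀ r → M B (B⁻¹ r) ≡ r
  M-B⁻¹ r = proj₂ (proj₂ (proj₂ (mf B hB) r))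

  B⁻¹-inj : ∀ {r r'} → B⁻¹ r ≡ B⁻¹ r' → r ≡ r'
  B⁻¹-inj {r} {r'} e = trans (sym (M-B⁻¹ r)) (trans (cong (M B) e) (M-B⁻¹ r'))

  -- The alternating walk stops when it reaches the partner of b in M_B.
  stop : Fin d
  stop = M B b

  reaches-b⇒stop : ∀ {r} → B⁻¹ r ≡ b → r ≡ stop
  reaches-b⇒stop {r} e = trans (sym (M-B⁻¹ r)) (cong (M B) e)

  B⁻¹∈A : ∀ {r} → r ≢ stop → B⁻¹ r ∈ A
  B⁻¹∈A {r} r≢stop with x∈p∪q⁻ A ⁅ b ⁆ (B⊆ (B⁻¹∈B r))
  ... | inj₁ x∈A = x∈A
  ... | inj₂ x∈b = ⊥-elim (r≢stop (reaches-b⇒stop (x∈⁅y⁆⇒x≡y b x∈b)))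

  step : Fin d → Fin d
  step r = M A (B⁻¹ r)

  step-inj : ∀ {r r'} → r ≢ stop → r' ≢ stop → step r ≡ step r' → r ≡ r'
  step-inj r≢ r'≢ e = B⁻¹-inj (injA (B⁻¹∈A r≢) (B⁻¹∈A r'≢) e)

  start-fresh : ∀ {r} → r ≢ stop → step r ≢ M A a
  start-fresh {r} r≢ e = a∉B (subst (_∈ B) (injA (B⁻¹∈A r≢) a∈A e) (B⁻¹∈B r))

  open Orbit step stop (M A a) step-inj start-fresh

  -- A walk first reaching stop after m+1 steps closes the cycle
  -- b, orbit 0, B⁻¹(orbit 0), orbit 1, …, B⁻¹(orbit m), orbit (m+1), b.
  closed-walk-cycle : ∀ m → Before Hits (suc m) → Hits (suc m) → Cycle G
  closed-walk-cycle m before hit = record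
    { m = m ; ls = ls ; rs = rs ; ls-inj = ls-inj ; rs-inj = rs-inj
    ; e-down = e-down ; e-up = e-up ; e-wrap = e-wrap }
    where
    A⊆τ : A ⊆ τ
    A⊆τ x∈A = x∈p∪q⁺ (inj₁ x∈A)

    ls : Fin (suc (suc m)) → Fin n
    ls zero = b
    ls (suc i) = B⁻¹ (orbit (toℕ i))

    rs : Fin (suc (suc m)) → Fin d
    rs i = orbit (toℕ i)

    avoids : ∀ (i : Fin (suc m)) → orbit (toℕ i) ≢ stop
    avoids i = before (toℕ i) (toℕ<n i)

    B⁻¹≢b : ∀ i → B⁻¹ (orbit (toℕ i)) ≢ b
    B⁻¹≢b i e = avoids i (reaches-b⇒stop e)

    rs-inj : ∀ {i j} → rs i ≡ rs j → i ≡ j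
    rs-inj {i} {j} e = toℕ-injective (orbit-injective before (≤-pred (toℕ<n i)) (≤-pred (toℕ<n j)) e)

    ls-inj : ∀ {i j} → ls i ≡ ls j → i ≡ j
    ls-inj {zero} {zero} _ = refl
    ls-inj {zero} {suc j} e = ⊥-elim (B⁻¹≢b j (sym e))
    ls-inj {suc i} {zero} e = ⊥-elim (B⁻¹≢b i e)
    ls-inj {suc i} {suc j} e = cong suc (toℕ-injective (orbit-injective before
      (m≤n⇒m≤1+n (≤-pred (toℕ<n i))) (m≤n⇒m≤1+n (≤-pred (toℕ<n j))) (B⁻¹-inj e)))

    e-down : ∀ i → G (ls i) (rs i)
    e-down zero = edge C⊆ hC b∈C Cb≡Aa
    e-down (suc i) = edge A⊆τ hA (B⁻¹∈A (avoids i)) refl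

    e-up : ∀ (i : Fin (suc m)) → G (ls (suc i)) (rs (inject₁ i))
    e-up i = edge B⊆ hB (B⁻¹∈B _) (trans (M-B⁻¹ _) (cong orbit (sym (toℕ-inject₁ i))))

    e-wrap : G (ls zero) (rs (fromℕ (suc m)))
    e-wrap = edge B⊆ hB b∈B (trans (sym hit) (cong orbit (sym (toℕ-fromℕ (suc m)))))

  linkage-exchange : M B b ≡ M A a
  linkage-exchange with orbit-reaches-stop
  ... | zero , _ , start≡stop = sym start≡stop
  ... | suc m , before , hit = ⊥-elim (acyclic (closed-walk-cycle m before hit))
    where
    acyclic : Acyclic G
    acyclic = proj₂ (proj₂ (lk τ (trans (card-add A b b∉A) (cong suc hA))))

module DegreeDrop {n d : ℕ} (hd : 1 ≤ d) (dn : d ≤ n)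
  (M : MatchingData n d) (mf : IsMatchingField M) (lk : IsLinkage M)
  {σ : Subset n} (hσ : ∣ σ ∣ ≡ d) {a s : Fin n} (a∈σ : a ∈ σ) (s∈σ : s ∈ σ) (s≢a : s ≢ a) where

  r : Fin d
  r = M σ a

  ChowEdge : Subset n → Fin n → Set
  ChowEdge ρ b = b ∈ ρ × M (co ρ b) b ≡ r

  -- Definitionally the predicate counted by φ M ρ r.
  chowEdge? : ∀ ρ → Decidable (ChowEdge ρ)
  chowEdge? ρ b = (b ∈? ρ) ×-dec (M (co ρ b) b ≟ r)

  edge-transfer : ∀ b → ChowEdge (co σ s) b → ChowEdge (co σ a) b
  edge-transfer b (b∈ρ' , e) with co⁻ b∈ρ'
  ... | inj₂ refl = ⊥-elim (s≢a (proj₁ (mf σ hσ) s∈σ a∈σ (trans (cong (λ τ → M τ s) (sym (co-involutive s∈σ))) e)))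
  ... | inj₁ b∉σ = co⁺ (inj₁ b∉σ) ,
    LinkageExchange.linkage-exchange M mf lk hσ a∈σ b∉σ
      (co-card-N hd dn (co-card-d hσ a∈σ) (co⁺ (inj₁ b∉σ))) co-co⊆ (co⁺ (inj₂ refl)) a∉B
      (co-card-N hd dn (co-card-d hσ s∈σ) (co⁺ (inj₁ b∉σ))) co-co⊆ (co⁺ (inj₂ refl)) e
    where
    a∉B : a ∉ co (co σ a) b
    a∉B a∈B with co-co⁻ a∈B
    ... | inj₁ (_ , a≢a) = a≢a refl
    ... | inj₂ refl = b∉σ a∈σ

  a-edge : ChowEdge (co σ a) a
  a-edge = co⁺ (inj₂ refl) , cong (λ τ → M τ a) (co-involutive a∈σ)

  a-no-edge : ¬ ChowEdge (co σ s) a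
  a-no-edge (a∈ρ' , _) with co⁻ a∈ρ'
  ... | inj₁ a∉σ = a∉σ a∈σ
  ... | inj₂ a≡s = s≢a (sym a≡s)

  degree-drop : φ M (co σ s) r < φ M (co σ a) r
  degree-drop = count-strict (chowEdge? (co σ s)) (chowEdge? (co σ a)) edge-transfer
                  (allFin n) (∈-allFin a) a-edge a-no-edge

theorem3p29 : (n d : ℕ) → 1 ≤ d → d ≤ n →
    (M M' : MatchingData n d) →
    IsMatchingField M → IsLinkage M →
    IsMatchingField M' → IsLinkage M' →
    (∀ (ρ : Subset n) → ∣ ρ ∣ ≡ n ∸ d + 1 → ∀ (r : Fin d) → φ M ρ r ≡ φ M' ρ r) →
    SameMatchingField M M'
theorem3p29 n d hd dn M M' mf lk mf' lk' hφ σ hσ ℓ ℓ∈σ with M σ ℓ ≟ M' σ ℓ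
... | yes same = same
... | no differ with proj₂ (mf σ hσ) (M' σ ℓ)
...   | s , s∈σ , Ms≡r = ⊥-elim (<-irrefl refl cycle-of-inequalities)
  where
  open ≤-Reasoning
  r = M' σ ℓ

  ℓ≢s : ℓ ≢ s
  ℓ≢s refl = differ Ms≡r

  cycle-of-inequalities : φ M (co σ ℓ) r < φ M (co σ ℓ) r
  cycle-of-inequalities = begin-strict
    φ M (co σ ℓ) r    <⟨ subst (λ q → φ M (co σ ℓ) q < φ M (co σ s) q) Ms≡r
                           (DegreeDrop.degree-drop hd dn M mf lk hσ s∈σ ℓ∈σ ℓ≢s) ⟩
    φ M (co σ s) r    ≡⟨ hφ (co σ s) (co-card-d hσ s∈σ) r ⟩
    φ M' (co σ s) r   <⟨ DegreeDrop.degree-drop hd dn M' mf' lk' hσ ℓ∈σ s∈σ (λ s≡ℓ → ℓ≢s (sym s≡ℓ)) ⟩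
    φ M' (co σ ℓ) r   ≡⟨ hφ (co σ ℓ) (co-card-d hσ ℓ∈σ) r ⟨
    φ M (co σ ℓ) r    ∎
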